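{- Let $C_n$ be the cycle graph on $n\ge 3$ vertices, $k$ a positive integer, and $j$ an integer with $0\le j\le\lfloor n/2\rfloor$. Then $$\lambda_j^k(C_n)=\begin{cases}\lambda_e^k(C_n) & \text{if } j=0,\\ 0 & \text{if } k\ge 3,\\ 0 & \text{if } k=2 \text{ and } j\ge 1,\\ \lambda_{j-1}^k(P_{n-1}) & \text{if } k=1 \text{ and } j\ge 1,\end{cases}$$ where $P_{n-1}$ is the path graph on $n-1$ vertices.
   Context: Let $\lambda(G)$ denote the chromatic index of a simple graph $G$. For a positive integer $k$ and a graph $G=(V,E)$, a set $E'\subseteq E$ is a $k$-chromatic index edge removal set if $\lambda(G-E')\le k$, and $\lambda_e^k(G)$ is the minimum size of such a set. For a nonnegative integer $j$, a set $E'\subseteq E$ is a $k$-chromatic index $j$-mixed edge removal set if there exists $V'\subseteq V$ with $|V'|=j$ such that $\lambda(G-V'-E')\le k$, where $G-V'-E'$ is obtained by deleting the vertices of $V'$ (with incident edges) and the remaining edges of $E'$; $\lambda_j^k(G)$ is the minimum size of such a set. -}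

module Defs where

open import Data.Nat as ℕ using (ℕ; zero; suc; _≤_)
open import Data.Fin using (Fin; zero; suc; toℕ; inject₁; lower₁)
open import Data.Fin.Subset using (Subset; _∈_; _∉_; ∣_∣)
open import Data.Product using (Σ; _×_; _,_; proj₁; proj₂; ∃-syntax)
open import Data.Sum using (_⊎_)
open import Relation.Binary.PropositionalEquality using (_≡_; _≢_)
open import Relation.Nullary using (yes; no)

record Graph (n : ℕ) : Set where
  field
    m    : ℕ
    ends : Fin m → Fin n × Fin n
open Graph public

Adjacent : ∀ {n} (G : Graph n) → Fin (m G) → Fin (m G) → Set
Adjacent G e f =
  let a = proj₁ (ends G e) ; b = proj₂ (ends G e)
      c = proj₁ (ends G f) ; d = proj₂ (ends G f)
  in a ≡ c ⊎ a ≡ d ⊎ b ≡ c ⊎ b ≡ d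

Survives : ∀ {n} (G : Graph n) → Subset n → Subset (m G) → Fin (m G) → Set
Survives G V' E' e = e ∉ E' × proj₁ (ends G e) ∉ V' × proj₂ (ends G e) ∉ V'

ChromIndexAtMost : ∀ {n} (G : Graph n) → Subset n → Subset (m G) → ℕ → Set
ChromIndexAtMost G V' E' k =
  Σ (Fin (m G) → Fin k) λ c →
    ∀ e f → Survives G V' E' e → Survives G V' E' f →
      e ≢ f → Adjacent G e f → c e ≢ c f

noVertices : ∀ n → Subset n
noVertices n = Data.Fin.Subset.⊥

IsEdgeRemovalSet : ∀ {n} (k : ℕ) (G : Graph n) → Subset (m G) → Set
IsEdgeRemovalSet {n} k G E' = ChromIndexAtMost G (noVertices n) E' k

IsMixedRemovalSet : ∀ {n} (k j : ℕ) (G : Graph n) → Subset (m G) → Set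
IsMixedRemovalSet {n} k j G E' =
  Σ (Subset n) λ V' → ∣ V' ∣ ≡ j × ChromIndexAtMost G V' E' k

IsMinSize : ∀ {t} → (Subset t → Set) → ℕ → Set
IsMinSize P r = (Σ (Subset _) λ E' → P E' × ∣ E' ∣ ≡ r)
              × (∀ E' → P E' → r ≤ ∣ E' ∣)

LambdaE : ∀ {n} (k : ℕ) (G : Graph n) → ℕ → Set
LambdaE k G r = IsMinSize (IsEdgeRemovalSet k G) r

LambdaJ : ∀ {n} (k j : ℕ) (G : Graph n) → ℕ → Set
LambdaJ k j G r = IsMinSize (IsMixedRemovalSet k j G) r

next : ∀ {n} → Fin (suc n) → Fin (suc n)
next {n} i with n ℕ.≟ toℕ i
... | yes _ = zero
... | no p  = suc (lower₁ i p)

Cycle : (n : ℕ) → Graph n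
Cycle zero    = record { m = zero ; ends = λ () }
Cycle (suc n) = record { m = suc n ; ends = λ i → i , next i }

Path : (n : ℕ) → Graph n
Path zero    = record { m = zero ; ends = λ () }
Path (suc n) = record { m = n ; ends = λ i → inject₁ i , suc i }

-- For k ≥ 3 the cycle is k-edge-colourable outright: colour the edges
-- 0, …, n-2 alternately and give the last edge a third colour. Deleting a
-- single vertex leaves a path, which is 2-edge-colourable, so for k = 2 any
-- j ≥ 1 deleted vertices suffice. For k = 1 the remaining graph must be a
-- matching; rotating the cycle moves one deleted vertex to position 0, and
-- C_n minus vertex 0 is a copy of P_{n-1}, on which the other j - 1 deleted
-- vertices and the removed edges act in the same way.
module Submission where

open import Defs
open import Data.Nat using (ℕ; _≤_; _≥_; _∸_; _/_)
open import Data.Product using (_×_)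
open import Function.Bundles using (_⇔_)
open import Relation.Binary.PropositionalEquality using (_≡_)

open import Data.Nat using (zero; suc; z≤n; s≤s; _<_; _≟_)
open import Data.Nat.Properties using (≤-refl; ≤-reflexive; ≤-trans; ≤-antisym; suc-injective; n≮0)
open import Data.Nat.DivMod using (m/n≤m)
open import Data.Fin using (Fin; zero; suc; toℕ; inject₁; inject≤; fromℕ)
open import Data.Fin.Properties
  using (toℕ-inject₁; toℕ-inject₁-≢; lower₁-inject₁′; toℕ-fromℕ; fromℕ≢inject₁; inject≤-injective)
  renaming (suc-injective to fsuc-injective; inject₁-injective to finject₁-injective)
open import Data.Fin.Relation.Unary.Top using (view; ‵fromℕ; ‵inj₁)
open import Data.Fin.Subset using (Subset; _∈_; _∉_; ∣_∣; inside; outside; ⊥; _-_; Nonempty)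
open import Data.Fin.Subset.Properties
  using (∣⊥∣≡0; ∣p∣≤∣x∷p∣; Empty-unique; nonempty?; x∈p⇒∣p-x∣<∣p∣)
open import Data.Vec using (Vec; []; _∷_; _∷ʳ_; initLast; _[_]=_; here; there)
open import Data.Product using (_,_; ∃-syntax; ∃₂)
import Data.Product as Product
open import Data.Bool using (Bool)
open import Data.Sum using (_⊎_; inj₁; inj₂)
import Data.Sum as Sum
open import Function using (_∘_; case_of_)
open import Function.Bundles using (mk⇔; Equivalence)
open import Relation.Binary.PropositionalEquality using (refl; sym; trans; cong; subst; subst₂; _≢_)
open import Relation.Nullary using (¬_; yes; no; contradiction)

private
  variable
    A : Set
    n n′ N M k j r : ℕ

IsMinSize-transfer : ∀ {s t} {P : Subset s → Set} {Q : Subset t → Set} →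
  (∀ {E} → P E → ∃[ F ] Q F × ∣ F ∣ ≤ ∣ E ∣) →
  (∀ {F} → Q F → ∃[ E ] P E × ∣ E ∣ ≤ ∣ F ∣) →
  IsMinSize P r → IsMinSize Q r
IsMinSize-transfer {r = r} {Q = Q} P⇒Q Q⇒P ((E , pE , ∣E∣≡r) , minimal)
  with F , qF , F≤E ← P⇒Q pE =
  (F , qF , ≤-antisym (≤-trans F≤E (≤-reflexive ∣E∣≡r)) (lowerBound qF)) , λ _ → lowerBound
  where
  lowerBound : ∀ {F′} → Q F′ → r ≤ ∣ F′ ∣
  lowerBound qF′ = let (E′ , pE′ , E′≤F′) = Q⇒P qF′ in ≤-trans (minimal E′ pE′) E′≤F′

IsMinSize-⇔ : ∀ {s t} {P : Subset s → Set} {Q : Subset t → Set} →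
  (∀ {E} → P E → ∃[ F ] Q F × ∣ F ∣ ≤ ∣ E ∣) →
  (∀ {F} → Q F → ∃[ E ] P E × ∣ E ∣ ≤ ∣ F ∣) →
  IsMinSize P r ⇔ IsMinSize Q r
IsMinSize-⇔ P⇒Q Q⇒P = mk⇔ (IsMinSize-transfer P⇒Q Q⇒P) (IsMinSize-transfer Q⇒P P⇒Q)

IsMinSize-cong : ∀ {s} {P Q : Subset s → Set} → (∀ {E} → P E ⇔ Q E) → IsMinSize P r ⇔ IsMinSize Q r
IsMinSize-cong P⇔Q = IsMinSize-⇔ (λ p → _ , Equivalence.to P⇔Q p , ≤-refl)
                                 (λ q → _ , Equivalence.from P⇔Q q , ≤-refl)

IsMinSize-zero : ∀ {s} {P : Subset s → Set} → P ⊥ → IsMinSize P 0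
IsMinSize-zero {s} p⊥ = (⊥ , p⊥ , ∣⊥∣≡0 s) , λ _ _ → z≤n

∣p∣≡0⇒p≡⊥ : {p : Subset n} → ∣ p ∣ ≡ 0 → p ≡ ⊥
∣p∣≡0⇒p≡⊥ {p = p} ∣p∣≡0 = Empty-unique λ (x , x∈p) →
  n≮0 (subst (∣ p - x ∣ <_) ∣p∣≡0 (x∈p⇒∣p-x∣<∣p∣ x∈p))

∣p∣≡suc⇒Nonempty : {p : Subset n} → ∣ p ∣ ≡ suc j → Nonempty p
∣p∣≡suc⇒Nonempty {n = n} {p = p} ∣p∣≡1+j with nonempty? p
... | yes ne = ne
... | no ¬ne = contradiction (trans (sym ∣p∣≡1+j) (trans (cong ∣_∣ (Empty-unique ¬ne)) (∣⊥∣≡0 n)))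
                             λ ()

∣p∷ʳx∣≡∣x∷p∣ : ∀ (p : Subset n) x → ∣ p ∷ʳ x ∣ ≡ ∣ x ∷ p ∣
∣p∷ʳx∣≡∣x∷p∣ []            x       = refl
∣p∷ʳx∣≡∣x∷p∣ (outside ∷ p) outside = ∣p∷ʳx∣≡∣x∷p∣ p outside
∣p∷ʳx∣≡∣x∷p∣ (outside ∷ p) inside  = ∣p∷ʳx∣≡∣x∷p∣ p inside
∣p∷ʳx∣≡∣x∷p∣ (inside ∷ p)  outside = cong suc (∣p∷ʳx∣≡∣x∷p∣ p outside)
∣p∷ʳx∣≡∣x∷p∣ (inside ∷ p)  inside  = cong suc (∣p∷ʳx∣≡∣x∷p∣ p inside)

∣p∣≤∣y∷p∷ʳx∣ : ∀ y (p : Subset n) x → ∣ p ∣ ≤ ∣ y ∷ (p ∷ʳ x) ∣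
∣p∣≤∣y∷p∷ʳx∣ y p x =
  ≤-trans (∣p∣≤∣x∷p∣ x p) (≤-trans (≤-reflexive (sym (∣p∷ʳx∣≡∣x∷p∣ p x))) (∣p∣≤∣x∷p∣ y (p ∷ʳ x)))

firstVertices : ∀ n → ℕ → Subset n
firstVertices zero    _       = []
firstVertices (suc n) zero    = ⊥
firstVertices (suc n) (suc j) = inside ∷ firstVertices n j

∣firstVertices∣ : j ≤ n → ∣ firstVertices n j ∣ ≡ j
∣firstVertices∣ {n = zero}  z≤n     = refl
∣firstVertices∣ {n = suc n} z≤n     = ∣⊥∣≡0 (suc n)
∣firstVertices∣ (s≤s j≤n) = cong suc (∣firstVertices∣ j≤n)

[]=-∷ʳ⁺ : {xs : Vec A n} {i : Fin n} {x y : A} → xs [ i ]= x → (xs ∷ʳ y) [ inject₁ i ]= x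
[]=-∷ʳ⁺ here      = here
[]=-∷ʳ⁺ (there p) = there ([]=-∷ʳ⁺ p)

[]=-∷ʳ⁻ : ∀ (xs : Vec A n) (i : Fin n) {x y : A} → (xs ∷ʳ y) [ inject₁ i ]= x → xs [ i ]= x
[]=-∷ʳ⁻ (_ ∷ _)  zero    here      = here
[]=-∷ʳ⁻ (_ ∷ xs) (suc i) (there p) = there ([]=-∷ʳ⁻ xs i p)

[]=-∷ʳ-fromℕ : ∀ (xs : Vec A n) {y : A} → (xs ∷ʳ y) [ fromℕ n ]= y
[]=-∷ʳ-fromℕ []       = here
[]=-∷ʳ-fromℕ (_ ∷ xs) = there ([]=-∷ʳ-fromℕ xs)

next-fromℕ : ∀ N → next (fromℕ N) ≡ zero
next-fromℕ N with N ≟ toℕ (fromℕ N)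
... | yes _   = refl
... | no N≢N = contradiction (sym (toℕ-fromℕ N)) N≢N

next-inject₁ : (i : Fin N) → next (inject₁ i) ≡ suc i
next-inject₁ {N} i with N ≟ toℕ (inject₁ i)
... | yes N≡i = contradiction N≡i (toℕ-inject₁-≢ i)
... | no N≢i  = cong suc (lower₁-inject₁′ i N≢i)

next-injective : {e f : Fin (suc N)} → next e ≡ next f → e ≡ f
next-injective {N} {e} {f} eq with view e | view f
... | ‵fromℕ      | ‵fromℕ      = refl
... | ‵fromℕ      | ‵inj₁ {i = w} _ =
  contradiction (trans (sym (next-fromℕ N)) (trans eq (next-inject₁ w))) λ ()
... | ‵inj₁ {i = v} _ | ‵fromℕ  =
  contradiction (trans (sym (next-fromℕ N)) (trans (sym eq) (next-inject₁ v))) λ ()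
... | ‵inj₁ {i = v} _ | ‵inj₁ {i = w} _ =
  cong inject₁ (fsuc-injective (trans (sym (next-inject₁ v)) (trans eq (next-inject₁ w))))

rotate : Vec A (suc N) → Vec A (suc N)
rotate (x ∷ xs) = xs ∷ʳ x

rotate-[]= : {xs : Vec A (suc N)} {i : Fin (suc N)} {x : A} → xs [ next i ]= x → rotate xs [ i ]= x
rotate-[]= {N = N} {xs = y ∷ xs} {i} p with view i
... | ‵fromℕ with subst ((y ∷ xs) [_]= _) (next-fromℕ N) p
...   | here = []=-∷ʳ-fromℕ xs
rotate-[]= {xs = y ∷ xs} p | ‵inj₁ {i = w} _ with subst ((y ∷ xs) [_]= _) (next-inject₁ w) p
...   | there q = []=-∷ʳ⁺ q

∣rotate∣ : (p : Subset (suc N)) → ∣ rotate p ∣ ≡ ∣ p ∣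
∣rotate∣ (x ∷ p) = ∣p∷ʳx∣≡∣x∷p∣ p x

-- Adjacent G e f unfolds to ShareEndpoint (ends G e) (ends G f).
ShareEndpoint : A × A → A × A → Set
ShareEndpoint (a , b) (c , d) = a ≡ c ⊎ a ≡ d ⊎ b ≡ c ⊎ b ≡ d

ShareEndpoint-map⁺ : ∀ {B : Set} (φ : A → B) {p q : A × A} →
  ShareEndpoint p q → ShareEndpoint (Product.map φ φ p) (Product.map φ φ q)
ShareEndpoint-map⁺ φ = Sum.map (cong φ) (Sum.map (cong φ) (Sum.map (cong φ) (cong φ)))

ShareEndpoint-map⁻ : ∀ {B : Set} {φ : A → B} → (∀ {x y} → φ x ≡ φ y → x ≡ y) →
  {p q : A × A} → ShareEndpoint (Product.map φ φ p) (Product.map φ φ q) → ShareEndpoint p q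
ShareEndpoint-map⁻ φ-inj = Sum.map φ-inj (Sum.map φ-inj (Sum.map φ-inj φ-inj))

RemainderIsMatching : (G : Graph n) → Subset n → Subset (m G) → Set
RemainderIsMatching G V E =
  ∀ e f → Survives G V E e → Survives G V E f → e ≢ f → ¬ Adjacent G e f

chromIndex≤1⇔matching : {G : Graph n} {V : Subset n} {E : Subset (m G)} →
  ChromIndexAtMost G V E 1 ⇔ RemainderIsMatching G V E
chromIndex≤1⇔matching = mk⇔
  (λ (c , proper) e f se sf e≢f adj → proper e f se sf e≢f adj (single (c e) (c f)))
  (λ matching → (λ _ → zero) , λ e f se sf e≢f adj _ → matching e f se sf e≢f adj)
  where
  single : (x y : Fin 1) → x ≡ y
  single zero zero = refl

ChromIndexAtMost-mono : {G : Graph n} {V : Subset n} {E : Subset (m G)} {k′ : ℕ} →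
  k ≤ k′ → ChromIndexAtMost G V E k → ChromIndexAtMost G V E k′
ChromIndexAtMost-mono k≤k′ (c , proper) =
  (λ e → inject≤ (c e) k≤k′) ,
  λ e f se sf e≢f adj → proper e f se sf e≢f adj ∘ inject≤-injective k≤k′ k≤k′ _ _

matching-pullback : ∀ (G : Graph n) (H : Graph n′) {V E V′ E′} (ψ : Fin (m G) → Fin (m H)) →
  (∀ {e f} → ψ e ≡ ψ f → e ≡ f) →
  (∀ {e} → Survives G V E e → Survives H V′ E′ (ψ e)) →
  (∀ {e f} → Adjacent G e f → Adjacent H (ψ e) (ψ f)) →
  RemainderIsMatching H V′ E′ → RemainderIsMatching G V E
matching-pullback G H ψ ψ-inj survives adjacent matching e f se sf e≢f adj =
  matching (ψ e) (ψ f) (survives se) (survives sf) (e≢f ∘ ψ-inj) (adjacent adj)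

matching-pushforward : ∀ (G : Graph n) (H : Graph n′) {V E V′ E′} (ψ : Fin (m H) → Fin (m G)) →
  (∀ {e} → Survives G V E e → ∃[ i ] e ≡ ψ i × Survives H V′ E′ i) →
  (∀ {i j} → Adjacent G (ψ i) (ψ j) → Adjacent H i j) →
  RemainderIsMatching H V′ E′ → RemainderIsMatching G V E
matching-pushforward G H ψ survivor adjacent matching e f se sf e≢f adj
  with survivor se | survivor sf
... | i , refl , si | j , refl , sj = matching i j si sj (e≢f ∘ cong ψ) (adjacent adj)

cycle-adjacent : {e f : Fin (suc N)} → e ≢ f → Adjacent (Cycle (suc N)) e f →
  f ≡ next e ⊎ e ≡ next f
cycle-adjacent e≢f (inj₁ e≡f)                = contradiction e≡f e≢f
cycle-adjacent e≢f (inj₂ (inj₁ e≡f⁺))        = inj₂ e≡f⁺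
cycle-adjacent e≢f (inj₂ (inj₂ (inj₁ e⁺≡f))) = inj₁ (sym e⁺≡f)
cycle-adjacent e≢f (inj₂ (inj₂ (inj₂ e⁺≡f⁺))) = contradiction (next-injective e⁺≡f⁺) e≢f

-- Consecutive edges e, next e share the vertex next e, so only they need checking.
cycle-edgeColouring : {V E : Subset (suc N)} (c : Fin (suc N) → Fin k) →
  (∀ e → next e ∉ V → c (next e) ≢ c e) → ChromIndexAtMost (Cycle (suc N)) V E k
cycle-edgeColouring c proper = c , λ e f (_ , _ , e⁺∉V) (_ , _ , f⁺∉V) e≢f adj ce≡cf →
  case cycle-adjacent e≢f adj of λ where
    (inj₁ refl) → proper e e⁺∉V (sym ce≡cf)
    (inj₂ refl) → proper f f⁺∉V ce≡cf

parity : ℕ → Fin 2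
parity zero          = zero
parity (suc zero)    = suc zero
parity (suc (suc i)) = parity i

parity-suc : ∀ i → parity (suc i) ≢ parity i
parity-suc zero          ()
parity-suc (suc zero)    ()
parity-suc (suc (suc i)) = parity-suc i

parity-next : (w : Fin N) → parity (toℕ (next (inject₁ w))) ≢ parity (toℕ (inject₁ w))
parity-next w rewrite next-inject₁ w | toℕ-inject₁ w = parity-suc (toℕ w)

colour3 : Fin (suc N) → Fin 3
colour3 e with view e
... | ‵fromℕ          = fromℕ 2
... | ‵inj₁ {i = w} _ = inject₁ (parity (toℕ w))

colour3-≢ : (e : Fin (suc N)) {w : Fin M} → toℕ e ≡ suc (toℕ w) →
  colour3 e ≢ inject₁ (parity (toℕ w))
colour3-≢ e {w} e≡1+w with view e
... | ‵fromℕ          = fromℕ≢inject₁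
... | ‵inj₁ {i = u} _ = parity-suc (toℕ w) ∘ subst (λ t → parity t ≡ _) u≡1+w ∘ finject₁-injective
  where
  u≡1+w : toℕ u ≡ suc (toℕ w)
  u≡1+w = trans (sym (toℕ-inject₁ u)) e≡1+w

colour3-next : (e : Fin (suc (suc N))) → colour3 (next e) ≢ colour3 e
colour3-next {N = N} e with view e
... | ‵fromℕ          = subst (λ e → colour3 e ≢ fromℕ 2) (sym (next-fromℕ (suc N))) λ ()
... | ‵inj₁ {i = w} _ = colour3-≢ (next (inject₁ w)) (cong toℕ (next-inject₁ w))

cycle-chromIndex≤3 : {V E : Subset (suc (suc N))} → 3 ≤ k →
  ChromIndexAtMost (Cycle (suc (suc N))) V E k
cycle-chromIndex≤3 3≤k =
  ChromIndexAtMost-mono 3≤k (cycle-edgeColouring colour3 λ e _ → colour3-next e)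

-- With vertex 0 deleted, the wrap-around from the last edge to edge 0 never has to be checked.
cycle-chromIndex≤2 : {V E : Subset (suc N)} → zero ∈ V → 2 ≤ k →
  ChromIndexAtMost (Cycle (suc N)) V E k
cycle-chromIndex≤2 {N = N} {V = V} 0∈V 2≤k =
  ChromIndexAtMost-mono 2≤k (cycle-edgeColouring (parity ∘ toℕ) proper)
  where
  proper : ∀ e → next e ∉ V → parity (toℕ (next e)) ≢ parity (toℕ e)
  proper e e⁺∉V with view e
  ... | ‵fromℕ          = contradiction (subst (_∈ V) (sym (next-fromℕ N)) 0∈V) e⁺∉V
  ... | ‵inj₁ {i = w} _ = parity-next w

matching-rotate : {V E : Subset (suc N)} →
  RemainderIsMatching (Cycle (suc N)) V E →
  RemainderIsMatching (Cycle (suc N)) (rotate V) (rotate E)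
matching-rotate = matching-pullback (Cycle _) (Cycle _) next next-injective
  (λ (e∉E , e∉V , e⁺∉V) → e∉E ∘ rotate-[]= , e∉V ∘ rotate-[]= , e⁺∉V ∘ rotate-[]=)
  (ShareEndpoint-map⁺ next)

rotate-to-zero : {P : Subset (suc N) → Subset (suc N) → Set} →
  (∀ {V E} → P V E → P (rotate V) (rotate E)) →
  ∀ {v V E} → v ∈ V → P V E → ∃₂ λ V′ E′ → zero ∈ V′ × P V′ E′
rotate-to-zero {P = P} step {v} = go (toℕ v) refl
  where
  go : ∀ t {v V E} → toℕ v ≡ t → v ∈ V → P V E → ∃₂ λ V′ E′ → zero ∈ V′ × P V′ E′
  go zero    {zero}  _  v∈V pVE = _ , _ , v∈V , pVE
  go (suc t) {suc w} {V} eq v∈V pVE =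
    go t (trans (toℕ-inject₁ w) (suc-injective eq))
      (rotate-[]= (subst (_∈ V) (sym (next-inject₁ w)) v∈V)) (step pVE)

pathEdge : Fin M → Fin (suc (suc M))
pathEdge i = suc (inject₁ i)

ends-pathEdge : (i : Fin M) →
  ends (Cycle (suc (suc M))) (pathEdge i) ≡ Product.map suc suc (ends (Path (suc M)) i)
ends-pathEdge i = cong (pathEdge i ,_) (next-inject₁ (suc i))

pathEdge-adjacent⁺ : {i j : Fin M} →
  Adjacent (Path (suc M)) i j → Adjacent (Cycle (suc (suc M))) (pathEdge i) (pathEdge j)
pathEdge-adjacent⁺ {i = i} {j} adj =
  subst₂ ShareEndpoint (sym (ends-pathEdge i)) (sym (ends-pathEdge j)) (ShareEndpoint-map⁺ suc adj)

pathEdge-adjacent⁻ : {i j : Fin M} →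
  Adjacent (Cycle (suc (suc M))) (pathEdge i) (pathEdge j) → Adjacent (Path (suc M)) i j
pathEdge-adjacent⁻ {i = i} {j} adj =
  ShareEndpoint-map⁻ fsuc-injective (subst₂ ShareEndpoint (ends-pathEdge i) (ends-pathEdge j) adj)

module _ {M} {W : Subset (suc M)} {F : Subset M} {e₀ x : Bool} where

  private
    C = Cycle (suc (suc M))
    P = Path (suc M)
    V = inside ∷ W
    E = e₀ ∷ (F ∷ʳ x)

  survives-pathEdge : ∀ {i} → Survives P W F i → Survives C V E (pathEdge i)
  survives-pathEdge {i} (i∉F , i∉W , i⁺∉W) =
    (λ { (there m) → i∉F ([]=-∷ʳ⁻ F i m) }) ,
    (λ { (there m) → i∉W m }) ,
    subst (_∉ V) (sym (next-inject₁ (suc i))) λ { (there m) → i⁺∉W m }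

  survivor-pathEdge : ∀ {e} → Survives C V E e → ∃[ i ] e ≡ pathEdge i × Survives P W F i
  survivor-pathEdge {zero} (_ , 0∉V , _) = contradiction here 0∉V
  survivor-pathEdge {suc w} (e∉E , e∉V , e⁺∉V) with view w
  ... | ‵fromℕ = contradiction (subst (_∈ V) (sym (next-fromℕ (suc M))) here) e⁺∉V
  ... | ‵inj₁ {i = i} _ = i , refl ,
    (i∉F , e∉V ∘ there , λ m → e⁺∉V (subst (_∈ V) (sym (next-inject₁ (suc i))) (there m)))
    where
    i∉F : i ∉ F
    i∉F m = e∉E (there ([]=-∷ʳ⁺ m))

  matching-cycle⇔path : RemainderIsMatching C V E ⇔ RemainderIsMatching P W F
  matching-cycle⇔path = mk⇔
    (matching-pullback P C pathEdge (finject₁-injective ∘ fsuc-injective) survives-pathEdge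
      pathEdge-adjacent⁺)
    (matching-pushforward C P pathEdge survivor-pathEdge pathEdge-adjacent⁻)

LambdaJ-zero⇔LambdaE : {G : Graph n} → LambdaJ k 0 G r ⇔ LambdaE k G r
LambdaJ-zero⇔LambdaE {n = n} = IsMinSize-cong (mk⇔
  (λ (V , ∣V∣≡0 , χ) → subst (λ V → ChromIndexAtMost _ V _ _) (∣p∣≡0⇒p≡⊥ ∣V∣≡0) χ)
  (λ χ → ⊥ , ∣⊥∣≡0 n , χ))

cycle-LambdaJ-k≥3 : 3 ≤ k → j ≤ suc (suc N) → LambdaJ k j (Cycle (suc (suc N))) 0
cycle-LambdaJ-k≥3 {j = j} {N = N} 3≤k j≤n =
  IsMinSize-zero (firstVertices (suc (suc N)) j , ∣firstVertices∣ j≤n , cycle-chromIndex≤3 3≤k)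

cycle-LambdaJ-k≥2 : 2 ≤ k → 1 ≤ j → j ≤ suc N → LambdaJ k j (Cycle (suc N)) 0
cycle-LambdaJ-k≥2 {j = j} {N = N} 2≤k (s≤s z≤n) j≤n =
  IsMinSize-zero (firstVertices (suc N) j , ∣firstVertices∣ j≤n , cycle-chromIndex≤2 here 2≤k)

cycle-LambdaJ-k≡1 : 1 ≤ j → LambdaJ 1 j (Cycle (suc (suc M))) r ⇔ LambdaJ 1 (j ∸ 1) (Path (suc M)) r
cycle-LambdaJ-k≡1 {j = suc j} {M = M} _ = IsMinSize-⇔ cycle⇒path path⇒cycle
  where
  C = Cycle (suc (suc M))
  P = Path (suc M)
  open Equivalence

  Invariant : Subset (suc (suc M)) → Subset (suc (suc M)) → Subset (suc (suc M)) → Set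
  Invariant E V′ E′ = ∣ V′ ∣ ≡ suc j × ∣ E′ ∣ ≡ ∣ E ∣ × RemainderIsMatching C V′ E′

  rotation-invariant : ∀ E {V′ E′} → Invariant E V′ E′ → Invariant E (rotate V′) (rotate E′)
  rotation-invariant E {V′} {E′} (∣V′∣≡1+j , ∣E′∣≡∣E∣ , matching) =
    trans (∣rotate∣ V′) ∣V′∣≡1+j , trans (∣rotate∣ E′) ∣E′∣≡∣E∣ , matching-rotate matching

  cycle⇒path : ∀ {E} → IsMixedRemovalSet 1 (suc j) C E →
    ∃[ F ] IsMixedRemovalSet 1 j P F × ∣ F ∣ ≤ ∣ E ∣
  cycle⇒path {E} (V , ∣V∣≡1+j , χ) with ∣p∣≡suc⇒Nonempty {p = V} ∣V∣≡1+j
  ... | v , v∈V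
    with rotate-to-zero {P = Invariant E} (rotation-invariant E) v∈V
                        (∣V∣≡1+j , refl , to chromIndex≤1⇔matching χ)
  ... | _ ∷ W , e₀ ∷ E₁ , here , ∣V′∣≡1+j , ∣E′∣≡∣E∣ , matching with initLast E₁
  ... | F , x , refl =
    F ,
    (W , suc-injective ∣V′∣≡1+j , from chromIndex≤1⇔matching (to matching-cycle⇔path matching)) ,
    ≤-trans (∣p∣≤∣y∷p∷ʳx∣ e₀ F x) (≤-reflexive ∣E′∣≡∣E∣)

  path⇒cycle : ∀ {F} → IsMixedRemovalSet 1 j P F →
    ∃[ E ] IsMixedRemovalSet 1 (suc j) C E × ∣ E ∣ ≤ ∣ F ∣
  path⇒cycle {F} (W , ∣W∣≡j , χ) =
    outside ∷ (F ∷ʳ outside) ,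
    (inside ∷ W , cong suc ∣W∣≡j ,
      from chromIndex≤1⇔matching (from matching-cycle⇔path (to chromIndex≤1⇔matching χ))) ,
    ≤-reflexive (∣p∷ʳx∣≡∣x∷p∣ F outside)

mainTheorem17 : (n k j : ℕ) → n ≥ 3 → k ≥ 1 → j ≤ n / 2 →
    ((j ≡ 0 → ∀ r → LambdaJ k j (Cycle n) r ⇔ LambdaE k (Cycle n) r)
    × (k ≥ 3 → LambdaJ k j (Cycle n) 0)
    × (k ≡ 2 → j ≥ 1 → LambdaJ k j (Cycle n) 0)
    × (k ≡ 1 → j ≥ 1 → ∀ r → LambdaJ k j (Cycle n) r ⇔ LambdaJ k (j ∸ 1) (Path (n ∸ 1)) r))
mainTheorem17 n k j (s≤s (s≤s (s≤s _))) _ j≤n/2 =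
  (λ { refl _ → LambdaJ-zero⇔LambdaE })
  , (λ 3≤k → cycle-LambdaJ-k≥3 3≤k j≤n)
  , (λ k≡2 1≤j → cycle-LambdaJ-k≥2 (≤-reflexive (sym k≡2)) 1≤j j≤n)
  , λ { refl 1≤j _ → cycle-LambdaJ-k≡1 1≤j }
  where
  j≤n : j ≤ n
  j≤n = ≤-trans j≤n/2 (m/n≤m n 2)
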